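{- Let $\Sigma$ be a signed graph with $n$ vertices and underlying graph $G$, let $\mu\notin\{0,1,-1\}$ be an eigenvalue of $\Sigma$ with multiplicity $k$, and let $t=n-k$. If $-\mu^2$ is not an eigenvalue of $G$, then $$n\le\binom{t+1}{2}.$$
   Context: A signed graph $\Sigma=(G,\sigma)$ consists of a simple graph $G$ (the underlying graph) and a sign function $\sigma$ assigning $\pm1$ to each edge. Its adjacency matrix is obtained from that of $G$ by replacing the entries $1$ corresponding to negative edges by $-1$; the eigenvalues of $\Sigma$ are those of this matrix, while the eigenvalues of $G$ are those of its ordinary adjacency matrix. -}

module Defs where

open import Level using (0ℓ)
open import Data.Nat using (ℕ; zero; suc)
open import Data.Fin using (Fin)
open import Data.Product using (Σ; ∃; _×_; _,_)
open import Data.Sum using (_⊎_)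
open import Relation.Nullary using (¬_)
open import Relation.Binary.PropositionalEquality using (_≡_)
open import Algebra.Bundles using (CommutativeRing)

record OrderedField : Set₁ where
  field
    commRing : CommutativeRing 0ℓ 0ℓ
  open CommutativeRing commRing public
  field
    _≤_        : Carrier → Carrier → Set
    ≤-refl     : ∀ {x y} → x ≈ y → x ≤ y
    ≤-trans    : ∀ {x y z} → x ≤ y → y ≤ z → x ≤ z
    ≤-antisym  : ∀ {x y} → x ≤ y → y ≤ x → x ≈ y
    ≤-total    : ∀ x y → x ≤ y ⊎ y ≤ x
    +-mono-≤   : ∀ {x y} z → x ≤ y → (x + z) ≤ (y + z)
    *-nonneg   : ∀ {x y} → 0# ≤ x → 0# ≤ y → 0# ≤ (x * y)
    0≉1        : ¬ (0# ≈ 1#)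
    inverse    : ∀ x → ¬ (x ≈ 0#) → ∃ λ y → (x * y) ≈ 1#

data Edge : Set where
  none plus minus : Edge

record SignedGraph (n : ℕ) : Set where
  field
    sgn    : Fin n → Fin n → Edge
    sym    : ∀ i j → sgn i j ≡ sgn j i
    irrefl : ∀ i → sgn i i ≡ none

module _ (F : OrderedField) where
  open OrderedField F

  sumF : (n : ℕ) → (Fin n → Carrier) → Carrier
  sumF zero    f = 0#
  sumF (suc n) f = f Fin.zero + sumF n (λ i → f (Fin.suc i))
    where import Data.Fin as Fin

  Matrix : ℕ → Set
  Matrix n = Fin n → Fin n → Carrier

  Vector : ℕ → Set
  Vector n = Fin n → Carrier

  signedAdj : ∀ {n} → SignedGraph n → Matrix n
  signedAdj Σ' i j with SignedGraph.sgn Σ' i j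
  ... | none  = 0#
  ... | plus  = 1#
  ... | minus = - 1#

  underlyingAdj : ∀ {n} → SignedGraph n → Matrix n
  underlyingAdj Σ' i j with SignedGraph.sgn Σ' i j
  ... | none  = 0#
  ... | plus  = 1#
  ... | minus = 1#

  InEigenspace : ∀ {n} → Matrix n → Carrier → Vector n → Set
  InEigenspace {n} M λ' x = ∀ i → sumF n (λ j → M i j * x j) ≈ λ' * x i

  NonZeroVec : ∀ {n} → Vector n → Set
  NonZeroVec x = ¬ (∀ i → x i ≈ 0#)

  IsEigenvalue : ∀ {n} → Matrix n → Carrier → Set
  IsEigenvalue M λ' = ∃ λ x → NonZeroVec x × InEigenspace M λ' x

  LinIndep : ∀ {m n} → (Fin m → Vector n) → Set
  LinIndep {m} {n} v =
    ∀ (c : Fin m → Carrier) →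
      (∀ i → sumF m (λ l → c l * v l i) ≈ 0#) → ∀ l → c l ≈ 0#

  -- λ is an eigenvalue of M of multiplicity k (dimension of eigenspace
  -- is exactly k; for symmetric real matrices this equals the
  -- algebraic multiplicity)
  HasMultiplicity : ∀ {n} → Matrix n → Carrier → ℕ → Set
  HasMultiplicity {n} M λ' k =
    (∃ λ (v : Fin k → Vector n) → (∀ l → InEigenspace M λ' (v l)) × LinIndep v)
    × (∀ (v : Fin (suc k) → Vector n) → (∀ l → InEigenspace M λ' (v l)) → ¬ LinIndep v)

module Submission where

-- Let S = A − μI, where A is the signed adjacency matrix.  Its kernel contains
-- k independent μ-eigenvectors of A, so the n columns of S lie in the span of
-- t = n − k vectors g₁ … g_t.  Squaring entrywise and using A_ij² = U_ij
-- (U the adjacency matrix of the underlying graph) gives S ∘ S = U + μ²I.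
-- Writing S_ij = Σ_p α_jp g_p(i), the identity
-- (Σ_p a_p b_p)² = Σ_{p≤q} (a_p a_q)(c_pq b_p b_q), c_pp = 1, c_pq = 2 (p < q),
-- puts every column of S ∘ S in the span of the t(t+1)/2 vectors built from
-- the products g_p g_q.  If −μ² is not an eigenvalue of U, then U + μ²I is
-- nonsingular, its n columns are independent, and so n ≤ t(t+1)/2 = C(t+1,2).
--
-- Independence of a family only ever yields the
-- double negation of "all coefficients vanish", so the linear algebra is done
-- in the double-negation monad, and the final inequality between naturals is
-- recovered because it is decidable.

open import Defs
open import Data.Nat using (ℕ; suc; _≤_; _∸_)
open import Data.Nat.Combinatorics using (_C_)
open import Relation.Nullary using (¬_)

open import Level using (0ℓ)
import Data.Nat as Nat
open import Data.Nat using (zero; z≤n; s≤s; _≤?_)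
open import Data.Nat.Combinatorics using (nC1≡n; nCk+nC[k+1]≡[n+1]C[k+1])
open import Data.Fin using (Fin; zero; suc; punchIn; punchOut; splitAt)
open import Data.Fin.Properties using (punchIn-punchOut; sequence) renaming (_≟_ to _≟ᶠ_)
open import Data.Vec.Functional using (_++_; tail)
open import Data.Product using (Σ; ∃; _×_; _,_; proj₁; proj₂)
open import Data.Sum using (inj₁; inj₂)
open import Data.Empty using (⊥-elim)
open import Data.Maybe using (nothing)
open import Relation.Nullary using (yes; no)
open import Relation.Nullary.Decidable using (decidable-stable)
open import Relation.Nullary.Negation using (¬¬-Monad)
open import Effect.Monad using (RawMonad)
open import Relation.Binary.PropositionalEquality using (_≡_; _≢_; _≗_; cong; cong₂; subst)
import Relation.Binary.PropositionalEquality as ≡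
open import Algebra.Bundles using (CommutativeRing)
open import Tactic.RingSolver.Core.AlmostCommutativeRing using (fromCommutativeRing)

open RawMonad (¬¬-Monad {0ℓ}) using (pure; _>>=_; _<$>_)

-- Triangular numbers: tri t = t + (t − 1) + ⋯ + 1, the number of pairs
-- p ≤ q in Fin t, i.e. the dimension of the symmetric square of a
-- t-dimensional space.
tri : ℕ → ℕ
tri zero    = zero
tri (suc t) = suc t Nat.+ tri t

tri≡C2 : ∀ t → tri t ≡ suc t C 2
tri≡C2 zero    = ≡.refl
tri≡C2 (suc t) = ≡.trans (cong₂ Nat._+_ (≡.sym (nC1≡n (suc t))) (tri≡C2 t))
                         (nCk+nC[k+1]≡[n+1]C[k+1] (suc t) 1)

¬∀⇒¬¬∃¬ : ∀ {N} {P : Fin N → Set} → ¬ (∀ j → P j) → ¬ ¬ (∃ λ j → ¬ P j)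
¬∀⇒¬¬∃¬ ¬all ¬∃ = sequence (RawMonad.rawApplicative ¬¬-Monad) (λ j ¬Pj → ¬∃ (j , ¬Pj)) ¬all

pivot-cases : ∀ {N} (j₀ : Fin (suc N)) {P : Fin (suc N) → Set} →
  P j₀ → (∀ j → P (punchIn j₀ j)) → ∀ j → P j
pivot-cases j₀ {P} p₀ p j with j₀ ≟ᶠ j
... | yes ≡.refl = p₀
... | no j₀≢j    = subst P (punchIn-punchOut j₀≢j) (p (punchOut j₀≢j))

tail-++ : ∀ {A : Set} {m n} (u : Fin (suc m) → A) (w : Fin n → A) →
  tail (u ++ w) ≗ tail u ++ w
tail-++ {m = m} u w i with splitAt m i
... | inj₁ _ = ≡.refl
... | inj₂ _ = ≡.refl

module Linear (R : CommutativeRing 0ℓ 0ℓ) where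
  open CommutativeRing R hiding (zero)
  open import Algebra.Properties.Ring ring
    using (-‿distribˡ-*; -‿distribʳ-*; -‿involutive; +-inverseʳ-unique)
  open import Algebra.Properties.Semiring.Sum semiring
    using (sum; sum-syntax; sum-cong-≋; sum-replicate-zero; ∑-distrib-+; ∑-comm; sum-remove;
           *-distribˡ-sum; *-distribʳ-sum)
  open import Tactic.RingSolver.NonReflective (fromCommutativeRing R (λ _ → nothing))
    using (solve; _⊜_; _⊕_; _⊗_)
  open import Relation.Binary.Reasoning.Setoid setoid

  Vec : ℕ → Set
  Vec n = Fin n → Carrier

  neg-square : ∀ x → - x * - x ≈ x * x
  neg-square x = begin
      - x * - x      ≈⟨ sym (-‿distribˡ-* x (- x)) ⟩
      - (x * - x)    ≈⟨ -‿cong (sym (-‿distribʳ-* x x)) ⟩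
      - - (x * x)    ≈⟨ -‿involutive _ ⟩
      x * x          ∎

  ∑-zero : ∀ {n} {f : Vec n} → (∀ i → f i ≈ 0#) → sum f ≈ 0#
  ∑-zero {n} f≈0 = trans (sum-cong-≋ f≈0) (sum-replicate-zero n)

  ∑-combination : ∀ {m d} (a : Vec m) (b : Fin m → Vec d) (g : Vec d) →
    ∑[ j < m ] (a j * ∑[ p < d ] (b j p * g p)) ≈ ∑[ p < d ] (∑[ j < m ] (a j * b j p) * g p)
  ∑-combination {m} {d} a b g = begin
      ∑[ j < m ] (a j * ∑[ p < d ] (b j p * g p))
    ≈⟨ sum-cong-≋ (λ j → trans (*-distribˡ-sum (a j) (λ p → b j p * g p))
                               (sum-cong-≋ {d} λ p → sym (*-assoc _ _ _))) ⟩
      ∑[ j < m ] ∑[ p < d ] ((a j * b j p) * g p)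
    ≈⟨ ∑-comm (λ j p → (a j * b j p) * g p) ⟩
      ∑[ p < d ] ∑[ j < m ] ((a j * b j p) * g p)
    ≈⟨ sum-cong-≋ (λ p → sym (*-distribʳ-sum (g p) (λ j → a j * b j p))) ⟩
      ∑[ p < d ] (∑[ j < m ] (a j * b j p) * g p) ∎

  δ : ∀ {n} → Fin n → Fin n → Carrier
  δ zero    zero    = 1#
  δ zero    (suc j) = 0#
  δ (suc i) zero    = 0#
  δ (suc i) (suc j) = δ i j

  δ-diag : ∀ {n} (i : Fin n) → δ i i ≈ 1#
  δ-diag zero    = refl
  δ-diag (suc i) = δ-diag i

  δ-off : ∀ {n} (i j : Fin n) → i ≢ j → δ i j ≈ 0#
  δ-off zero    zero    0≢0 = ⊥-elim (0≢0 ≡.refl)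
  δ-off zero    (suc j) _   = refl
  δ-off (suc i) zero    _   = refl
  δ-off (suc i) (suc j) i≢j = δ-off i j (λ i≡j → i≢j (cong suc i≡j))

  ∑-δ : ∀ {n} (i : Fin n) (f : Vec n) → ∑[ j < n ] (δ i j * f j) ≈ f i
  ∑-δ {suc n} zero    f = trans (+-cong (*-identityˡ _) (∑-zero {n} λ _ → zeroˡ _)) (+-identityʳ _)
  ∑-δ {suc n} (suc i) f = trans (+-cong (zeroˡ _) (∑-δ i (tail f))) (+-identityˡ _)

  IsRelation : ∀ {N n} → (Fin N → Vec n) → Vec N → Set
  IsRelation {N} v x = ∀ i → ∑[ j < N ] (x j * v j i) ≈ 0#

  InSpan : ∀ {d n} → (Fin d → Vec n) → Vec n → Set
  InSpan {d} g w = ∃ λ (α : Vec d) → ∀ i → w i ≈ ∑[ p < d ] (α p * g p i)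

  -- Linear independence, double-negated: every relation can not fail to be
  -- trivial.  This is the form that non-singularity hypotheses stated as
  -- "¬ IsEigenvalue" provide.
  Independent : ∀ {k N} → (Fin k → Vec N) → Set
  Independent x = ∀ c → IsRelation x c → ¬ ¬ (∀ l → c l ≈ 0#)

  relation-combination : ∀ {N n} {v : Fin N → Vec n} {x y : Vec N} →
    IsRelation v x → IsRelation v y → ∀ ρ → IsRelation v (λ j → x j + ρ * y j)
  relation-combination {N} {v = v} {x} {y} x-rel y-rel ρ i = begin
      ∑[ j < N ] ((x j + ρ * y j) * v j i)
    ≈⟨ sum-cong-≋ {N} (λ j → trans (distribʳ _ _ _) (+-congˡ (*-assoc _ _ _))) ⟩
      ∑[ j < N ] (x j * v j i + ρ * (y j * v j i))
    ≈⟨ ∑-distrib-+ (λ j → x j * v j i) (λ j → ρ * (y j * v j i)) ⟩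
      ∑[ j < N ] (x j * v j i) + ∑[ j < N ] (ρ * (y j * v j i))
    ≈⟨ +-cong (x-rel i) (sym (*-distribˡ-sum ρ (λ j → y j * v j i))) ⟩
      0# + ρ * ∑[ j < N ] (y j * v j i)
    ≈⟨ +-identityˡ _ ⟩
      ρ * ∑[ j < N ] (y j * v j i)
    ≈⟨ trans (*-congˡ (y-rel i)) (zeroʳ ρ) ⟩
      0# ∎

  relation-drop : ∀ {N n} {v : Fin (suc N) → Vec n} {x : Vec (suc N)} (j₀ : Fin (suc N)) →
    IsRelation v x → x j₀ ≈ 0# → IsRelation (λ j → v (punchIn j₀ j)) (λ j → x (punchIn j₀ j))
  relation-drop {v = v} {x} j₀ x-rel xj₀≈0 i = begin
      ∑[ j < _ ] (x (punchIn j₀ j) * v (punchIn j₀ j) i)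
    ≈⟨ sym (+-identityˡ _) ⟩
      0# + ∑[ j < _ ] (x (punchIn j₀ j) * v (punchIn j₀ j) i)
    ≈⟨ +-congʳ (trans (sym (zeroˡ (v j₀ i))) (*-congʳ (sym xj₀≈0))) ⟩
      x j₀ * v j₀ i + ∑[ j < _ ] (x (punchIn j₀ j) * v (punchIn j₀ j) i)
    ≈⟨ sym (sum-remove {i = j₀} (λ j → x j * v j i)) ⟩
      ∑[ j < _ ] (x j * v j i)
    ≈⟨ x-rel i ⟩
      0# ∎

  span-self : ∀ {d n} (g : Fin d → Vec n) p → InSpan g (g p)
  span-self g p = δ p , λ i → sym (∑-δ p (λ q → g q i))

  span-combination : ∀ {m d n} (g : Fin d → Vec n) (w : Fin m → Vec n) →
    (∀ j → InSpan g (w j)) → (a : Vec m) → InSpan g (λ i → ∑[ j < m ] (a j * w j i))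
  span-combination {m} g w spans a =
    (λ p → ∑[ j < m ] (a j * proj₁ (spans j) p)) ,
    λ i → trans (sum-cong-≋ {m} (λ j → *-congˡ (proj₂ (spans j) i)))
                (∑-combination a (λ j → proj₁ (spans j)) (λ p → g p i))

  span-resp : ∀ {d n} {g : Fin d → Vec n} {w w′ : Vec n} →
    (∀ i → w i ≈ w′ i) → InSpan g w′ → InSpan g w
  span-resp w≈w′ (α , w′≈) = α , λ i → trans (w≈w′ i) (w′≈ i)

  dot : ∀ {t} → Vec t → Vec t → Carrier
  dot {t} a b = ∑[ p < t ] (a p * b p)

  dot-++ : ∀ {m n} (a a′ : Vec m) (b b′ : Vec n) →
    dot (a ++ b) (a′ ++ b′) ≈ dot a a′ + dot b b′
  dot-++ {zero}      a a′ b b′ = sym (+-identityˡ _)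
  dot-++ {suc m} {n} a a′ b b′ = begin
      a zero * a′ zero + dot (tail (a ++ b)) (tail (a′ ++ b′))
    ≈⟨ +-congˡ (sum-cong-≋ {m Nat.+ n} λ i →
          reflexive (cong₂ _*_ (tail-++ a b i) (tail-++ a′ b′ i))) ⟩
      a zero * a′ zero + dot (tail a ++ b) (tail a′ ++ b′)
    ≈⟨ +-congˡ (dot-++ (tail a) (tail a′) b b′) ⟩
      a zero * a′ zero + (dot (tail a) (tail a′) + dot b b′)
    ≈⟨ sym (+-assoc _ _ _) ⟩
      dot a a′ + dot b b′ ∎

  sym² : ∀ t → Vec t → Vec (tri t)
  sym² zero    a = λ ()
  sym² (suc t) a = (λ q → a zero * a q) ++ sym² t (tail a)

  weightedRow : ∀ {t} → Vec (suc t) → Vec (suc t)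
  weightedRow b zero    = b zero * b zero
  weightedRow b (suc q) = b zero * b (suc q) + b zero * b (suc q)

  sym²′ : ∀ t → Vec t → Vec (tri t)
  sym²′ zero    b = λ ()
  sym²′ (suc t) b = weightedRow b ++ sym²′ t (tail b)

  -- The square of a bilinear form is a bilinear form on the symmetric square:
  -- ⟨a, b⟩² = ⟨sym² a, sym²′ b⟩.  This is where the dimension tri t enters.
  square-of-dot : ∀ t (a b : Vec t) → dot a b * dot a b ≈ dot (sym² t a) (sym²′ t b)
  square-of-dot zero    a b = zeroˡ 0#
  square-of-dot (suc t) a b = sym (begin
      dot (sym² (suc t) a) (sym²′ (suc t) b)
    ≈⟨ dot-++ (λ q → a₀ * a q) (weightedRow b) (sym² t (tail a)) (sym²′ t (tail b)) ⟩
      ((a₀ * a₀) * (b₀ * b₀) + ∑[ q < t ] ((a₀ * a (suc q)) * (b₀ * b (suc q) + b₀ * b (suc q))))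
        + dot (sym² t (tail a)) (sym²′ t (tail b))
    ≈⟨ +-cong (+-congˡ cross-terms) (sym (square-of-dot t (tail a) (tail b))) ⟩
      ((a₀ * a₀) * (b₀ * b₀) + ((a₀ * b₀) * r + (a₀ * b₀) * r)) + r * r
    ≈⟨ solve 3 (λ x y z → (((x ⊗ x) ⊗ (y ⊗ y) ⊕ ((x ⊗ y) ⊗ z ⊕ (x ⊗ y) ⊗ z)) ⊕ z ⊗ z)
                          ⊜ ((x ⊗ y ⊕ z) ⊗ (x ⊗ y ⊕ z))) refl a₀ b₀ r ⟩
      dot a b * dot a b ∎)
    where
    a₀ = a zero
    b₀ = b zero
    r = dot (tail a) (tail b)
    regroup : ∀ u w → (a₀ * u) * (b₀ * w) ≈ (a₀ * b₀) * (u * w)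
    regroup = solve 4 (λ x y u w → ((x ⊗ u) ⊗ (y ⊗ w)) ⊜ ((x ⊗ y) ⊗ (u ⊗ w))) refl a₀ b₀
    cross-terms : ∑[ q < t ] ((a₀ * a (suc q)) * (b₀ * b (suc q) + b₀ * b (suc q)))
                  ≈ (a₀ * b₀) * r + (a₀ * b₀) * r
    cross-terms = begin
        ∑[ q < t ] ((a₀ * a (suc q)) * (b₀ * b (suc q) + b₀ * b (suc q)))
      ≈⟨ sum-cong-≋ {t} (λ q → trans (distribˡ _ _ _)
           (+-cong (regroup (a (suc q)) (b (suc q))) (regroup (a (suc q)) (b (suc q))))) ⟩
        ∑[ q < t ] ((a₀ * b₀) * (a (suc q) * b (suc q)) + (a₀ * b₀) * (a (suc q) * b (suc q)))
      ≈⟨ ∑-distrib-+ (λ q → (a₀ * b₀) * (a (suc q) * b (suc q)))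
                     (λ q → (a₀ * b₀) * (a (suc q) * b (suc q))) ⟩
        ∑[ q < t ] ((a₀ * b₀) * (a (suc q) * b (suc q)))
          + ∑[ q < t ] ((a₀ * b₀) * (a (suc q) * b (suc q)))
      ≈⟨ +-cong (sym (*-distribˡ-sum (a₀ * b₀) (λ q → a (suc q) * b (suc q))))
                (sym (*-distribˡ-sum (a₀ * b₀) (λ q → a (suc q) * b (suc q)))) ⟩
        (a₀ * b₀) * r + (a₀ * b₀) * r ∎

  -- Over a field (R nontrivial, nonzero elements invertible; equality need
  -- not be decidable).
  module OverField (0≉1 : ¬ (0# ≈ 1#)) (inverse : ∀ x → ¬ (x ≈ 0#) → ∃ λ y → x * y ≈ 1#) where

    independent-head-nonzero : ∀ {k N} (x : Fin (suc k) → Vec N) → Independent x →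
      ¬ (∀ j → x zero j ≈ 0#)
    independent-head-nonzero x ind x₀≈0 =
      ind (δ zero) (λ j → trans (∑-δ zero (λ l → x l j)) (x₀≈0 j)) (λ δ≈0 → 0≉1 (sym (δ≈0 zero)))

    -- The relations x₀ … x_k among
    -- v₀ … v_N are pivoted on a coordinate j₀ where x₀ is invertible
    -- (x₀ j₀ · y = 1): clearing the j₀-th coordinate of the others leaves k
    -- independent relations among the N vectors other than v_{j₀}, and v_{j₀}
    -- is a combination of those vectors.
    module Pivot {k N n} (v : Fin (suc N) → Vec n) (x : Fin (suc k) → Vec (suc N))
                 (rel : ∀ l → IsRelation v (x l))
                 (j₀ : Fin (suc N)) (y : Carrier) (pivot : x zero j₀ * y ≈ 1#) where

      others : Fin N → Vec n
      others j = v (punchIn j₀ j)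

      -- the multiple of x₀ that clears the j₀-th coordinate of x_{l+1}
      ρ : Fin k → Carrier
      ρ l = - (x (suc l) j₀ * y)

      cleared : Fin k → Vec (suc N)
      cleared l j = x (suc l) j + ρ l * x zero j

      cleared-pivot : ∀ l → cleared l j₀ ≈ 0#
      cleared-pivot l = begin
          b + - (b * y) * x zero j₀
        ≈⟨ +-congˡ (sym (-‿distribˡ-* (b * y) (x zero j₀))) ⟩
          b + - ((b * y) * x zero j₀)
        ≈⟨ +-congˡ (-‿cong (trans (*-assoc _ _ _) (*-congˡ (trans (*-comm _ _) pivot)))) ⟩
          b + - (b * 1#)
        ≈⟨ +-congˡ (-‿cong (*-identityʳ b)) ⟩
          b + - b
        ≈⟨ -‿inverseʳ b ⟩
          0# ∎
        where b = x (suc l) j₀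

      reduced : Fin k → Vec N
      reduced l j = cleared l (punchIn j₀ j)

      reduced-relation : ∀ l → IsRelation others (reduced l)
      reduced-relation l =
        relation-drop {v = v} {x = cleared l} j₀
          (relation-combination {v = v} {x (suc l)} {x zero} (rel (suc l)) (rel zero) (ρ l))
          (cleared-pivot l)

      -- A relation c among the reduced vectors lifts to the relation
      -- (Σ_l c_l ρ_l, c) among the x_l, so the reduced family stays independent.
      reduced-independent : Independent x → Independent reduced
      reduced-independent ind c c-rel = (λ lifted≈0 l → lifted≈0 (suc l)) <$> ind lifted lifted-rel
        where
        lifted : Vec (suc k)
        lifted zero    = ∑[ l < k ] (c l * ρ l)
        lifted (suc l) = c l

        expand : ∀ j → ∑[ L < suc k ] (lifted L * x L j) ≈ ∑[ l < k ] (c l * cleared l j)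
        expand j = sym (begin
            ∑[ l < k ] (c l * (x (suc l) j + ρ l * x zero j))
          ≈⟨ sum-cong-≋ {k} (λ l → trans (distribˡ _ _ _) (+-congˡ (sym (*-assoc _ _ _)))) ⟩
            ∑[ l < k ] (c l * x (suc l) j + (c l * ρ l) * x zero j)
          ≈⟨ ∑-distrib-+ (λ l → c l * x (suc l) j) (λ l → (c l * ρ l) * x zero j) ⟩
            ∑[ l < k ] (c l * x (suc l) j) + ∑[ l < k ] ((c l * ρ l) * x zero j)
          ≈⟨ +-congˡ (sym (*-distribʳ-sum (x zero j) (λ l → c l * ρ l))) ⟩
            ∑[ l < k ] (c l * x (suc l) j) + lifted zero * x zero j
          ≈⟨ +-comm _ _ ⟩
            ∑[ L < suc k ] (lifted L * x L j) ∎)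

        lifted-rel : IsRelation x lifted
        lifted-rel = pivot-cases j₀
          (trans (expand j₀) (∑-zero {k} λ l → trans (*-congˡ (cleared-pivot l)) (zeroʳ _)))
          (λ j → trans (expand (punchIn j₀ j)) (c-rel j))

      pivot-in-terms-of-others :
        ∀ i → v j₀ i ≈ ∑[ j < N ] ((- y * x zero (punchIn j₀ j)) * others j i)
      pivot-in-terms-of-others i = begin
          v j₀ i
        ≈⟨ sym (*-identityˡ _) ⟩
          1# * v j₀ i
        ≈⟨ *-congʳ (sym pivot) ⟩
          (a * y) * v j₀ i
        ≈⟨ trans (*-congʳ (*-comm a y)) (*-assoc y a (v j₀ i)) ⟩
          y * (a * v j₀ i)
        ≈⟨ *-congˡ (+-inverseʳ-unique B (a * v j₀ i) (trans (+-comm _ _) pivot-relation)) ⟩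
          y * - B
        ≈⟨ sym (-‿distribʳ-* y B) ⟩
          - (y * B)
        ≈⟨ -‿distribˡ-* y B ⟩
          - y * B
        ≈⟨ *-distribˡ-sum (- y) (λ j → x zero (punchIn j₀ j) * others j i) ⟩
          ∑[ j < N ] (- y * (x zero (punchIn j₀ j) * others j i))
        ≈⟨ sum-cong-≋ {N} (λ j → sym (*-assoc _ _ _)) ⟩
          ∑[ j < N ] ((- y * x zero (punchIn j₀ j)) * others j i) ∎
        where
        a = x zero j₀
        B = ∑[ j < N ] (x zero (punchIn j₀ j) * others j i)
        pivot-relation : a * v j₀ i + B ≈ 0#
        pivot-relation = trans (sym (sum-remove {i = j₀} (λ j → x zero j * v j i))) (rel zero i)

      span-all : ∀ {d} (g : Fin d → Vec n) → (∀ j → InSpan g (others j)) → ∀ j → InSpan g (v j)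
      span-all g spans = pivot-cases j₀
        (span-resp pivot-in-terms-of-others (span-combination g others spans _))
        spans

    SpannedByFewer : ∀ (k N : ℕ) {n} → (Fin N → Vec n) → Set
    SpannedByFewer k N {n} v = k ≤ N × Σ (Fin (N ∸ k) → Vec n) λ g → ∀ j → InSpan g (v j)

    rank-bound : ∀ k N {n} (v : Fin N → Vec n) (x : Fin k → Vec N) →
      (∀ l → IsRelation v (x l)) → Independent x → ¬ ¬ SpannedByFewer k N v
    rank-bound zero    N       v x rel ind = pure (z≤n , v , span-self v)
    rank-bound (suc k) zero    v x rel ind = ⊥-elim (independent-head-nonzero x ind (λ ()))
    rank-bound (suc k) (suc N) v x rel ind = do
      (j₀ , x₀j₀≉0) ← ¬∀⇒¬¬∃¬ (independent-head-nonzero x ind)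
      let (y , pivot) = inverse (x zero j₀) x₀j₀≉0
          open Pivot v x rel j₀ y pivot
      (k≤N , g , spans) ← rank-bound k N others reduced reduced-relation (reduced-independent ind)
      pure (s≤s k≤N , g , span-all g spans)

    -- k independent vectors in Rᴺ force k ≤ N: rank-bound for N vectors in R⁰,
    -- among which every vector of Rᴺ is a relation.
    independent-≤ : ∀ {k N} (x : Fin k → Vec N) → Independent x → ¬ ¬ (k ≤ N)
    independent-≤ {k} {N} x ind = proj₁ <$> rank-bound k N {0} (λ _ ()) x (λ _ ()) ind

    -- Steinitz: m independent vectors in the span of d vectors force m ≤ d,
    -- since their coefficient vectors in Rᵈ are independent.
    span-bound : ∀ {m d N} (u : Fin m → Vec N) (g : Fin d → Vec N) →
      (∀ j → InSpan g (u j)) → Independent u → ¬ ¬ (m ≤ d)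
    span-bound {m} {d} u g spans ind = independent-≤ coefficients coefficients-independent
      where
      coefficients : Fin m → Vec d
      coefficients j = proj₁ (spans j)

      coefficients-independent : Independent coefficients
      coefficients-independent c c-rel = ind c λ i → begin
          ∑[ j < m ] (c j * u j i)
        ≈⟨ sum-cong-≋ {m} (λ j → *-congˡ (proj₂ (spans j) i)) ⟩
          ∑[ j < m ] (c j * ∑[ p < d ] (coefficients j p * g p i))
        ≈⟨ ∑-combination c coefficients (λ p → g p i) ⟩
          ∑[ p < d ] (∑[ j < m ] (c j * coefficients j p) * g p i)
        ≈⟨ ∑-zero {d} (λ p → trans (*-congʳ (c-rel p)) (zeroˡ _)) ⟩
          0# ∎

module Bridge (F : OrderedField) where
  open OrderedField F hiding (zero)
  open import Algebra.Properties.Semiring.Sum semiring using (sum)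
  open Linear commRing using (Vec; Independent)

  sumF≡sum : ∀ m (f : Vec m) → sumF F m f ≡ sum f
  sumF≡sum zero    f = ≡.refl
  sumF≡sum (suc m) f = cong (f zero +_) (sumF≡sum m (tail f))

  LinIndep⇒Independent : ∀ {k n} {x : Fin k → Vec n} → LinIndep F x → Independent x
  LinIndep⇒Independent {k} ind c c-rel =
    pure (ind c (λ i → trans (reflexive (sumF≡sum k _)) (c-rel i)))

module Spectral (F : OrderedField) {n : ℕ} (Σ' : SignedGraph n) (μ : OrderedField.Carrier F) where
  open OrderedField F hiding (zero; _≤_; ≤-refl; ≤-trans; ≤-antisym; ≤-total; +-mono-≤)
  open import Algebra.Properties.Ring ring using (+-inverseʳ-unique; -‿distribˡ-*)
  open import Algebra.Properties.Semiring.Sum semiring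
    using (sum-syntax; sum-cong-≋; ∑-distrib-+; *-distribˡ-sum)
  open import Tactic.RingSolver.NonReflective (fromCommutativeRing commRing (λ _ → nothing))
    using (solve; _⊜_; _⊕_; _⊗_)
  open import Relation.Binary.Reasoning.Setoid setoid
  open Linear commRing
  open OverField 0≉1 inverse
  open Bridge F

  A U : Matrix F n
  A = signedAdj F Σ'
  U = underlyingAdj F Σ'

  column : Matrix F n → Fin n → Vec n
  column M j i = M i j

  signed-square : ∀ i j → A i j * A i j ≈ U i j
  signed-square i j with SignedGraph.sgn Σ' i j
  ... | none  = zeroˡ 0#
  ... | plus  = *-identityˡ 1#
  ... | minus = trans (neg-square 1#) (*-identityˡ 1#)

  A-diagonal : ∀ i → A i i ≈ 0#
  A-diagonal i rewrite SignedGraph.irrefl Σ' i = refl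

  U-diagonal : ∀ i → U i i ≈ 0#
  U-diagonal i rewrite SignedGraph.irrefl Σ' i = refl

  S : Matrix F n
  S i j = A i j + - μ * δ i j

  S∘S : Matrix F n
  S∘S i j = S i j * S i j

  S∘S≈U+μ²I : ∀ i j → S∘S i j ≈ U i j + (μ * μ) * δ i j
  S∘S≈U+μ²I i j with i ≟ᶠ j
  ... | yes ≡.refl = begin
      S i i * S i i
    ≈⟨ *-cong diagonal diagonal ⟩
      - μ * - μ
    ≈⟨ neg-square μ ⟩
      μ * μ
    ≈⟨ sym (+-identityˡ _) ⟩
      0# + μ * μ
    ≈⟨ +-cong (sym (U-diagonal i)) (sym (trans (*-congˡ (δ-diag i)) (*-identityʳ _))) ⟩
      U i i + (μ * μ) * δ i i ∎
    where
    diagonal : S i i ≈ - μ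
    diagonal = trans (+-cong (A-diagonal i) (trans (*-congˡ (δ-diag i)) (*-identityʳ _)))
                     (+-identityˡ _)
  ... | no i≢j = begin
      S i j * S i j
    ≈⟨ *-cong off-diagonal off-diagonal ⟩
      A i j * A i j
    ≈⟨ signed-square i j ⟩
      U i j
    ≈⟨ sym (trans (+-congˡ (trans (*-congˡ (δ-off i j i≢j)) (zeroʳ _))) (+-identityʳ _)) ⟩
      U i j + (μ * μ) * δ i j ∎
    where
    off-diagonal : S i j ≈ A i j
    off-diagonal = trans (+-congˡ (trans (*-congˡ (δ-off i j i≢j)) (zeroʳ _))) (+-identityʳ _)

  eigenvector-relation : ∀ {x} → InEigenspace F A μ x → IsRelation (column S) x
  eigenvector-relation {x} eigen i = begin
      ∑[ j < n ] (x j * (A i j + - μ * δ i j))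
    ≈⟨ sum-cong-≋ {n} (λ j → solve 4 (λ u a m d → (u ⊗ (a ⊕ m ⊗ d)) ⊜ (a ⊗ u ⊕ m ⊗ (d ⊗ u)))
                                     refl (x j) (A i j) (- μ) (δ i j)) ⟩
      ∑[ j < n ] (A i j * x j + - μ * (δ i j * x j))
    ≈⟨ ∑-distrib-+ (λ j → A i j * x j) (λ j → - μ * (δ i j * x j)) ⟩
      ∑[ j < n ] (A i j * x j) + ∑[ j < n ] (- μ * (δ i j * x j))
    ≈⟨ +-cong (trans (reflexive (≡.sym (sumF≡sum n _))) (eigen i))
              (trans (sym (*-distribˡ-sum (- μ) (λ j → δ i j * x j))) (*-congˡ (∑-δ i x))) ⟩
      μ * x i + - μ * x i
    ≈⟨ sym (distribʳ (x i) μ (- μ)) ⟩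
      (μ + - μ) * x i
    ≈⟨ trans (*-congʳ (-‿inverseʳ μ)) (zeroˡ _) ⟩
      0# ∎

  -- If −μ² is not an eigenvalue of U, then U + μ²I = S ∘ S is nonsingular:
  -- a relation c among its columns would satisfy U c = −μ² c.
  squared-columns-independent : ¬ IsEigenvalue F U (- (μ * μ)) → Independent (column S∘S)
  squared-columns-independent notEigen c c-rel c≉0 = notEigen (c , c≉0 , eigen)
    where
    balance : ∀ i → ∑[ j < n ] (U i j * c j) + (μ * μ) * c i ≈ 0#
    balance i = begin
        ∑[ j < n ] (U i j * c j) + (μ * μ) * c i
      ≈⟨ +-congˡ (*-congˡ (sym (∑-δ i c))) ⟩
        ∑[ j < n ] (U i j * c j) + (μ * μ) * ∑[ j < n ] (δ i j * c j)
      ≈⟨ +-congˡ (*-distribˡ-sum (μ * μ) (λ j → δ i j * c j)) ⟩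
        ∑[ j < n ] (U i j * c j) + ∑[ j < n ] ((μ * μ) * (δ i j * c j))
      ≈⟨ sym (∑-distrib-+ (λ j → U i j * c j) (λ j → (μ * μ) * (δ i j * c j))) ⟩
        ∑[ j < n ] (U i j * c j + (μ * μ) * (δ i j * c j))
      ≈⟨ sum-cong-≋ {n} (λ j → sym (trans (*-congˡ (S∘S≈U+μ²I i j))
           (solve 4 (λ u w m d → (u ⊗ (w ⊕ m ⊗ d)) ⊜ (w ⊗ u ⊕ m ⊗ (d ⊗ u)))
                    refl (c j) (U i j) (μ * μ) (δ i j)))) ⟩
        ∑[ j < n ] (c j * S∘S i j)
      ≈⟨ c-rel i ⟩
        0# ∎

    eigen : InEigenspace F U (- (μ * μ)) c
    eigen i = begin
        sumF F n (λ j → U i j * c j)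
      ≡⟨ sumF≡sum n _ ⟩
        ∑[ j < n ] (U i j * c j)
      ≈⟨ +-inverseʳ-unique ((μ * μ) * c i) _ (trans (+-comm _ _) (balance i)) ⟩
        - ((μ * μ) * c i)
      ≈⟨ -‿distribˡ-* (μ * μ) (c i) ⟩
        - (μ * μ) * c i ∎

  square-span : ∀ {t} → (Fin t → Vec n) → Fin (tri t) → Vec n
  square-span {t} g P i = sym²′ t (λ p → g p i) P

  -- If g spans the columns of S, then square-span g spans those of S ∘ S:
  -- S_ij² = ⟨α_j, g(i)⟩² = ⟨sym² α_j, sym²′ g(i)⟩.
  squared-columns-in-span : ∀ {t} (g : Fin t → Vec n) →
    (∀ j → InSpan g (column S j)) → ∀ j → InSpan (square-span g) (column S∘S j)
  squared-columns-in-span {t} g spans j = sym² t α , λ i →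
    trans (*-cong (S-in-span i) (S-in-span i)) (square-of-dot t α (λ p → g p i))
    where
    α = proj₁ (spans j)
    S-in-span = proj₂ (spans j)

  bound : ∀ {k} (v : Fin k → Vec n) → (∀ l → InEigenspace F A μ (v l)) → LinIndep F v →
    ¬ IsEigenvalue F U (- (μ * μ)) → ¬ ¬ (n ≤ tri (n ∸ k))
  bound {k} v eigen ind notEigen = do
    (_ , g , spans) ← rank-bound k n (column S) v (λ l → eigenvector-relation (eigen l))
                                 (LinIndep⇒Independent ind)
    span-bound (column S∘S) (square-span g) (squared-columns-in-span g spans)
               (squared-columns-independent notEigen)

-- Theorem 4.4: n ≤ C(t + 1, 2) with t = n − k.  The bound holds up to double
-- negation by Spectral.bound, and ≤ on ℕ is decidable.
theorem4p4 : (F : OrderedField) → let module K = OrderedField F in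
    (n : ℕ) (Σ' : SignedGraph n) (μ : K.Carrier) (k : ℕ) →
    ¬ (μ K.≈ K.0#) → ¬ (μ K.≈ K.1#) → ¬ (μ K.≈ K.- K.1#) →
    IsEigenvalue F (signedAdj F Σ') μ →
    HasMultiplicity F (signedAdj F Σ') μ k →
    ¬ IsEigenvalue F (underlyingAdj F Σ') (K.- (μ K.* μ)) →
    n ≤ (suc (n ∸ k)) C 2
theorem4p4 F n Σ' μ k _ _ _ _ ((v , eigen , ind) , _) notEigen =
  decidable-stable (n ≤? suc (n ∸ k) C 2)
    (subst (λ m → ¬ ¬ (n ≤ m)) (tri≡C2 (n ∸ k)) (Spectral.bound F Σ' μ v eigen ind notEigen))
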